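{- Let $G$ be an edge-colored $K^{(3)}_n$ containing no rainbow copy of $\mathcal{T}$. Then $G$ contains no rainbow copy of $C^{(3)}_3$, of $S^{(3)}_3$, or of $\mathbb{S}^{(3)}_3$.
   Context: A copy is rainbow if its edges have pairwise distinct colors. $K^{(3)}_n$ is the complete 3-uniform hypergraph on $n$ vertices. $\mathcal{T}$ has edges $\{v_1v_2v_3,v_2v_3v_4,v_3v_4v_5\}$. The loose cycle $C^{(3)}_3$ has vertices $v_1,\ldots,v_6$ and edges $\{v_1v_2v_3,v_3v_4v_5,v_5v_6v_1\}$. The loose star $S^{(3)}_3$ has vertices $v_0,\ldots,v_6$ and edges $\{v_0v_1v_2,v_0v_3v_4,v_0v_5v_6\}$. $\mathbb{S}^{(3)}_3$ has vertices $u,v,v_1,v_2,v_3$ and edges $\{uvv_1,uvv_2,uvv_3\}$ (all listed vertices distinct). -}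

module Defs where

open import Data.Nat using (ℕ)
open import Data.Fin using (Fin; #_)
open import Data.Product using (Σ; _×_)
open import Relation.Binary.PropositionalEquality using (_≡_; _≢_)
open import Function.Definitions using (Injective)

-- An edge-colouring of the complete 3-uniform hypergraph K^(3)_n on vertex set Fin n
-- with colours in C: a colour for every triple, invariant under permuting the triple
-- (values on triples with repeated vertices are irrelevant: never used below).
record EdgeColouring (n : ℕ) (C : Set) : Set where
  field
    col   : Fin n → Fin n → Fin n → C
    swap₁ : ∀ a b d → col a b d ≡ col b a d
    swap₂ : ∀ a b d → col a b d ≡ col a d b
open EdgeColouring public

Distinct3 : {C : Set} → C → C → C → Set
Distinct3 x y z = (x ≢ y) × (x ≢ z) × (y ≢ z)

module _ {n : ℕ} {C : Set} (G : EdgeColouring n C) where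
  private c = col G

  -- rainbow copy of T : edges v1v2v3, v2v3v4, v3v4v5 (vertices indexed 0..4)
  RainbowT : Set
  RainbowT = Σ (Fin 5 → Fin n) λ v → Injective _≡_ _≡_ v ×
    Distinct3 (c (v (# 0)) (v (# 1)) (v (# 2)))
              (c (v (# 1)) (v (# 2)) (v (# 3)))
              (c (v (# 2)) (v (# 3)) (v (# 4)))

  -- rainbow loose cycle C^(3)_3 : edges v1v2v3, v3v4v5, v5v6v1 (indexed 0..5)
  RainbowC33 : Set
  RainbowC33 = Σ (Fin 6 → Fin n) λ v → Injective _≡_ _≡_ v ×
    Distinct3 (c (v (# 0)) (v (# 1)) (v (# 2)))
              (c (v (# 2)) (v (# 3)) (v (# 4)))
              (c (v (# 4)) (v (# 5)) (v (# 0)))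

  -- rainbow loose star S^(3)_3 : edges v0v1v2, v0v3v4, v0v5v6 (indexed 0..6)
  RainbowS33 : Set
  RainbowS33 = Σ (Fin 7 → Fin n) λ v → Injective _≡_ _≡_ v ×
    Distinct3 (c (v (# 0)) (v (# 1)) (v (# 2)))
              (c (v (# 0)) (v (# 3)) (v (# 4)))
              (c (v (# 0)) (v (# 5)) (v (# 6)))

  -- rainbow 𝕊^(3)_3 : vertices u,v,v1,v2,v3 (indexed 0..4), edges uvv1, uvv2, uvv3
  RainbowSS33 : Set
  RainbowSS33 = Σ (Fin 5 → Fin n) λ v → Injective _≡_ _≡_ v ×
    Distinct3 (c (v (# 0)) (v (# 1)) (v (# 2)))
              (c (v (# 0)) (v (# 1)) (v (# 3)))
              (c (v (# 0)) (v (# 1)) (v (# 4)))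

{-# OPTIONS --safe #-}
-- Since no copy of 𝒯 is rainbow, two of the three edges of every tight path share a colour, so
-- the colour of an edge is pinned down by the tight paths through it.
-- In the loose cycle, v₁v₃v₅ is the middle edge of a tight path between any two of the three
-- edges, so its colour would lie in every pair of three distinct colours. In 𝕊, the colours of
-- uv₁v₂ and vv₂v₃ are forced to be those of uvv₃ and uvv₁, which makes the tight path
-- v₁uv₂vv₃ rainbow. Tight paths through the centre of the loose star are paths of three edges
-- in its link, where the star is a rainbow matching; the link edge v₁v₃ is then forced to have
-- the colour of v₁v₂ as well as that of v₃v₄.
module Submission where

open import Defs
open import Agda.Builtin.FromNat using (Number; fromNat)
open import Data.Nat using (ℕ; _≤ᵇ_)
open import Data.Bool using (true; false; if_then_else_)
open import Data.Fin using (Fin; toℕ; _≟_)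
open import Data.Fin.Literals using (number)
open import Data.Fin.Properties using (all?)
open import Data.Product using (_×_; _,_; proj₁; proj₂; uncurry)
open import Data.Vec using (_∷_; []; lookup)
open import Data.Unit using (⊤; tt)
open import Function using (_∘_)
open import Function.Definitions using (Injective)
open import Relation.Nullary using (¬_; Dec)
open import Relation.Nullary.Decidable using (True; toWitness; map′; _→-dec_)
open import Relation.Binary.PropositionalEquality
  using (_≡_; _≢_; refl; sym; trans; subst; ≢-sym; module ≡-Reasoning)

instance
  finNumber : {m : ℕ} → Number (Fin m)
  finNumber {m} = number m

  -- discharges the bound constraints of Fin numerals
  unit : ⊤
  unit = tt

private
  variable
    m k : ℕ
    X : Set

module _ {C : Set} where

  -- Colours need not have decidable equality, so forced colours are only known up to ¬¬.
  _≈_ : C → C → Set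
  x ≈ y = ¬ x ≢ y

  private
    variable
      a b c x y z x′ y′ z′ : C

  ≈-refl : x ≈ x
  ≈-refl x≢x = x≢x refl

  ≢-resp-≈ : x′ ≈ x → y′ ≈ y → x ≢ y → x′ ≢ y′
  ≢-resp-≈ x′≈x y′≈y x≢y x′≡y′ =
    x′≈x λ x′≡x → y′≈y λ y′≡y → x≢y (trans (sym x′≡x) (trans x′≡y′ y′≡y))

  Distinct3-resp-≈ : x′ ≈ x → y′ ≈ y → z′ ≈ z → Distinct3 x y z → Distinct3 x′ y′ z′
  Distinct3-resp-≈ x′≈x y′≈y z′≈z (x≢y , x≢z , y≢z) =
    ≢-resp-≈ x′≈x y′≈y x≢y , ≢-resp-≈ x′≈x z′≈z x≢z , ≢-resp-≈ y′≈y z′≈z y≢z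

  middle-≢ : ¬ Distinct3 x y z → Distinct3 x a z → y ≢ a
  middle-≢ ¬xyz xaz refl = ¬xyz xaz

  last-≢ : ¬ Distinct3 x y z → Distinct3 x y a → z ≢ a
  last-≢ ¬xyz xya refl = ¬xyz xya

  Distinct3-swap₁₂ : Distinct3 x y z → Distinct3 y x z
  Distinct3-swap₁₂ (x≢y , x≢z , y≢z) = ≢-sym x≢y , y≢z , x≢z

  Distinct3-swap₂₃ : Distinct3 x y z → Distinct3 x z y
  Distinct3-swap₂₃ (x≢y , x≢z , y≢z) = x≢z , x≢y , ≢-sym y≢z

  Distinct3-reverse : Distinct3 x y z → Distinct3 z y x
  Distinct3-reverse (x≢y , x≢z , y≢z) = ≢-sym y≢z , ≢-sym x≢z , ≢-sym x≢y

  middle-≈ : Distinct3 a b c → ¬ Distinct3 a y c → ¬ Distinct3 b y c → y ≈ c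
  middle-≈ abc@(_ , _ , b≢c) ¬ayc ¬byc y≢c =
    ¬byc (≢-sym (middle-≢ ¬ayc abc) , b≢c , y≢c)

  last-≈ : Distinct3 c a b → ¬ Distinct3 c a x → ¬ Distinct3 c b x → x ≈ c
  last-≈ cab@(_ , c≢b , _) ¬cax ¬cbx x≢c =
    ¬cbx (c≢b , ≢-sym x≢c , ≢-sym (last-≢ ¬cax cab))

  -- In the link of the centre of a loose star with matching edges 12, 34, 56 of colours a, b, c,
  -- let x, y, z be the colours of 13, 35, 15: if x ≠ b, then y = c and z = b, and 2156 is rainbow.
  cross≈ : {a b c x y z : C} → Distinct3 a b c →
           ¬ Distinct3 a x b → ¬ Distinct3 x y c → ¬ Distinct3 b y c →
           ¬ Distinct3 b x z → ¬ Distinct3 b y z → ¬ Distinct3 a z c → x ≈ b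
  cross≈ {a} {b} {c} {x} {y} {z} abc@(_ , _ , b≢c) ¬axb ¬xyc ¬byc ¬bxz ¬byz ¬azc x≢b =
    ¬azc (Distinct3-resp-≈ ≈-refl z≈b ≈-refl abc)
    where
    x≢c : x ≢ c
    x≢c = middle-≢ ¬axb (Distinct3-swap₂₃ abc)
    y≈c : y ≈ c
    y≈c = middle-≈ (x≢b , x≢c , b≢c) ¬xyc ¬byc
    z≈b : z ≈ b
    z≈b = last-≈ (≢-sym x≢b , ≢-resp-≈ ≈-refl y≈c b≢c , ≢-resp-≈ ≈-refl y≈c x≢c) ¬bxz ¬byz

-- Comparing with _≤ᵇ_ rather than _≤?_ keeps normalisation of numeral triples cheap.
sort₂ : Fin m → Fin m → Fin m × Fin m
sort₂ i j = if toℕ i ≤ᵇ toℕ j then (i , j) else (j , i)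

uncurry-sort₂ : (f : Fin m → Fin m → X) → (∀ i j → f i j ≡ f j i) →
                ∀ i j → uncurry f (sort₂ i j) ≡ f i j
uncurry-sort₂ f f-sym i j with toℕ i ≤ᵇ toℕ j
... | true  = refl
... | false = f-sym j i

sort₃ : Fin m → Fin m → Fin m → Fin m × Fin m × Fin m
sort₃ i j k =
  let (a , b) = sort₂ i j ; (b′ , d) = sort₂ b k ; (a′ , b″) = sort₂ a b′ in a′ , b″ , d

uncurry-sort₃ : (f : Fin m → Fin m → Fin m → X) →
                (∀ i j k → f i j k ≡ f j i k) → (∀ i j k → f i j k ≡ f i k j) →
                ∀ i j k → let (a , b , d) = sort₃ i j k in f a b d ≡ f i j k
uncurry-sort₃ {m = m} f swap₁₂ swap₂₃ i j k = begin
  f a′ b″ d ≡⟨ uncurry-sort₂ (λ x y → f x y d) (λ x y → swap₁₂ x y d) a b′ ⟩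
  f a b′ d  ≡⟨ uncurry-sort₂ (f a) (swap₂₃ a) b k ⟩
  f a b k   ≡⟨ uncurry-sort₂ (λ x y → f x y k) (λ x y → swap₁₂ x y k) i j ⟩
  f i j k   ∎
  where
  open ≡-Reasoning
  a b b′ d a′ b″ : Fin m
  a = proj₁ (sort₂ i j)
  b = proj₂ (sort₂ i j)
  b′ = proj₁ (sort₂ b k)
  d = proj₂ (sort₂ b k)
  a′ = proj₁ (sort₂ a b′)
  b″ = proj₂ (sort₂ a b′)

injective? : (f : Fin k → Fin m) → Dec (Injective _≡_ _≡_ f)
injective? f =
  map′ (λ inj {x} {y} → inj x y) (λ inj x y → inj)
       (all? λ x → all? λ y → f x ≟ f y →-dec x ≟ y)

module _ {n : ℕ} {C : Set} (G : EdgeColouring n C) (v : Fin m → Fin n) where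

  -- The colour of {v i, v j, v k} read off in increasing index order, so that for numerals the
  -- colour of an index triple is the same term in every order.
  colour : Fin m → Fin m → Fin m → C
  colour i j k = let (a , b , d) = sort₃ i j k in col G (v a) (v b) (v d)

  colour≡col : ∀ i j k → colour i j k ≡ col G (v i) (v j) (v k)
  colour≡col = uncurry-sort₃ (λ i j k → col G (v i) (v j) (v k))
                 (λ i j k → swap₁ G (v i) (v j) (v k)) (λ i j k → swap₂ G (v i) (v j) (v k))

module _ {n : ℕ} {C : Set} (G : EdgeColouring n C) (noT : ¬ RainbowT G) where

  module TightPaths (v : Fin m → Fin n) (v-inj : Injective _≡_ _≡_ v) where

    ¬rainbow : (a b d e f : Fin m) → {True (injective? (lookup (a ∷ b ∷ d ∷ e ∷ f ∷ [])))} →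
               ¬ Distinct3 (colour G v a b d) (colour G v b d e) (colour G v d e f)
    ¬rainbow a b d e f {distinct} rainbow
      rewrite colour≡col G v a b d | colour≡col G v b d e | colour≡col G v d e f =
      noT (v ∘ lookup (a ∷ b ∷ d ∷ e ∷ f ∷ []) , toWitness distinct ∘ v-inj , rainbow)

  ¬rainbowC33 : ¬ RainbowC33 G
  ¬rainbowC33 (v , v-inj , rainbow₀) =
    ¬rainbow 1 2 0 4 5 (Distinct3-resp-≈ ≈-refl d≈B ≈-refl rainbow)
    where
    open TightPaths v v-inj
    rainbow : Distinct3 (colour G v 0 1 2) (colour G v 2 3 4) (colour G v 4 5 0)
    rainbow = subst (Distinct3 _ _) (sym (colour≡col G v 4 5 0)) rainbow₀
    d≈B : colour G v 0 2 4 ≈ colour G v 2 3 4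
    d≈B = middle-≈ (Distinct3-swap₂₃ rainbow) (¬rainbow 1 0 2 4 3) (¬rainbow 5 0 4 2 3)

  ¬rainbowS33 : ¬ RainbowS33 G
  ¬rainbowS33 (v , v-inj , rainbow@(A≢B , _)) = x≈B (≢-resp-≈ x≈A ≈-refl A≢B)
    where
    open TightPaths v v-inj
    -- ¬rainbow i j 0 k l is the path i j k l in the link of the centre 0.
    x≈B : colour G v 0 1 3 ≈ colour G v 0 3 4
    x≈B = cross≈ rainbow
      (¬rainbow 2 1 0 3 4) (¬rainbow 1 3 0 5 6) (¬rainbow 4 3 0 5 6)
      (¬rainbow 4 3 0 1 5) (¬rainbow 4 3 0 5 1) (¬rainbow 2 1 0 5 6)
    x≈A : colour G v 0 1 3 ≈ colour G v 0 1 2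
    x≈A = cross≈ (Distinct3-swap₁₂ rainbow)
      (¬rainbow 4 3 0 1 2) (¬rainbow 3 1 0 5 6) (¬rainbow 2 1 0 5 6)
      (¬rainbow 2 1 0 3 5) (¬rainbow 2 1 0 5 3) (¬rainbow 4 3 0 5 6)

  ¬rainbowSS33 : ¬ RainbowSS33 G
  ¬rainbowSS33 (v , v-inj , rainbow) =
    ¬rainbow 2 0 3 1 4 (Distinct3-resp-≈ g≈C ≈-refl h≈A (Distinct3-reverse rainbow))
    where
    open TightPaths v v-inj
    g≈C : colour G v 0 2 3 ≈ colour G v 0 1 4
    g≈C = last-≈ (Distinct3-reverse rainbow) (¬rainbow 4 1 0 3 2) (¬rainbow 4 1 0 2 3)
    h≈A : colour G v 1 3 4 ≈ colour G v 0 1 2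
    h≈A = last-≈ rainbow (¬rainbow 2 0 1 3 4) (¬rainbow 2 0 1 4 3)

lemma2p1 : (n : ℕ) (C : Set) (G : EdgeColouring n C) → ¬ RainbowT G →
    ¬ RainbowC33 G × ¬ RainbowS33 G × ¬ RainbowSS33 G
lemma2p1 n C G noT = ¬rainbowC33 G noT , ¬rainbowS33 G noT , ¬rainbowSS33 G noT
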